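{- Let $Q$ be an $n\times n$ symmetric integer matrix, $p$ a prime, $k$ a positive integer and $t,s$ integers with $\mathrm{sym}_{p^k}(t)=\mathrm{sym}_{p^k}(s)$. Then $A_{p^k}(Q,t)=A_{p^k}(Q,s)$, $B_{p^k}(Q,t)=B_{p^k}(Q,s)$ and $C_{p^k}(Q,t)=C_{p^k}(Q,s)$.
   Context: $\mathrm{ord}_p(a)$ is the largest $e$ with $p^e\mid a$ ($\mathrm{ord}_p(0)=\infty$); $\mathrm{cop}_p(a)=a/p^{\mathrm{ord}_p(a)}$. $\mathrm{sgn}_p(0)=0$; for $a\ne0$, $\mathrm{sgn}_p(a)=\left(\frac{\mathrm{cop}_p(a)}{p}\right)$ (Legendre symbol) if $p$ odd and $\mathrm{cop}_2(a)\bmod 8$ if $p=2$. $\mathrm{sym}_{p^k}(t)=(\mathrm{ord}_p(t\bmod p^k),\mathrm{sgn}_p(t\bmod p^k))$ with $t\bmod p^k\in\{0,\dots,p^k-1\}$. $A_{p^k}(Q,t)$, $B_{p^k}(Q,t)$, $C_{p^k}(Q,t)$ are the numbers of all, primitive, and non-primitive $x\in(\mathbb{Z}/p^k\mathbb{Z})^n$ with $x^{T}Qx\equiv t\pmod{p^k}$, where $x$ is primitive if some coordinate is coprime to $p$. -}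

module Defs where

open import Data.Nat as ℕ using (ℕ; zero; suc; _≟_)
open import Data.Nat.DivMod using (_/_; _%_)
open import Data.Nat.Divisibility using (_∣_; _∣?_)
open import Data.Integer as ℤ using (ℤ; +_; _%ℕ_)
open import Data.Fin using (Fin; toℕ)
open import Data.Fin.Properties using (any?)
open import Data.Maybe using (Maybe; just; nothing)
open import Data.Product using (_×_; ∃; _,_)
open import Data.List using (List; []; _∷_; map; concatMap; filter; length)
open import Data.List.Membership.Propositional using ()
open import Data.Vec.Functional using (Vector) renaming (_∷_ to _∷ᵥ_; [] to []ᵥ)
open import Data.Fin using (Fin)
open import Data.List using (allFin)
open import Relation.Nullary using (Dec; yes; no; ¬?; ¬_)
open import Relation.Binary.PropositionalEquality using (_≡_)

∑ : ∀ {n} → (Fin n → ℤ) → ℤ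
∑ {zero}  f = + 0
∑ {suc n} f = f Fin.zero ℤ.+ ∑ (λ i → f (Fin.suc i))

-- ord_p(a) for a natural number a; ord_p(0) = ∞ is represented by nothing.
-- Recursion with fuel a (enough since p ≥ 2 and p^e ≤ a); only meaningful for p ≥ 2.
ordAux : ℕ → ℕ → ℕ → ℕ
ordAux zero    p a = 0
ordAux (suc f) (suc (suc q)) a with a % suc (suc q) ≟ 0
... | yes _ = suc (ordAux f (suc (suc q)) (a / suc (suc q)))
... | no _  = 0
ordAux (suc f) p a = 0

ord : ℕ → ℕ → Maybe ℕ
ord p zero    = nothing
ord p (suc a) = just (ordAux (suc a) p (suc a))

-- cop_p(a) = a / p^{ord_p(a)}  (same fuel convention; cop_p(0) = 0)
copAux : ℕ → ℕ → ℕ → ℕ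
copAux zero    p a = a
copAux (suc f) (suc (suc q)) a with a % suc (suc q) ≟ 0
... | yes _ = copAux f (suc (suc q)) (a / suc (suc q))
... | no _  = a
copAux (suc f) p a = a

cop : ℕ → ℕ → ℕ
cop p a = copAux a p a

legendre : ℕ → ℕ → ℤ
legendre zero a = + 0
legendre (suc q) a with suc q ∣? a
... | yes _ = + 0
... | no _ with any? {n = suc q} (λ (x : Fin (suc q)) → (toℕ x ℕ.* toℕ x) % suc q ≟ a % suc q)
...   | yes _ = + 1
...   | no _  = ℤ.-[1+ 0 ]

sgn : ℕ → ℕ → ℤ
sgn p zero = + 0
sgn 2 (suc a) = + (cop 2 (suc a) % 8)
sgn p (suc a) = legendre p (cop p (suc a))

-- t mod m in {0,…,m-1} (m ≥ 1; the value for m = 0 is an unused convention).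
_mod_ : ℤ → ℕ → ℕ
t mod zero    = 0
t mod (suc m) = t %ℕ suc m

sym : ℕ → ℕ → ℤ → Maybe ℕ × ℤ
sym p k t = ord p (t mod (p ℕ.^ k)) , sgn p (t mod (p ℕ.^ k))

qf : ∀ {n m} → (Fin n → Fin n → ℤ) → Vector (Fin m) n → ℤ
qf Q x = ∑ (λ i → ∑ (λ j → + toℕ (x i) ℤ.* Q i j ℤ.* + toℕ (x j)))

allVecs : ∀ n m → List (Vector (Fin m) n)
allVecs zero    m = []ᵥ ∷ []
allVecs (suc n) m = concatMap (λ v → map (_∷ᵥ v) (allFin m)) (allVecs n m)

Primitive : ∀ {n m} → ℕ → Vector (Fin m) n → Set
Primitive p x = ∃ λ i → ¬ (p ∣ toℕ (x i))

primitive? : ∀ {n m} p (x : Vector (Fin m) n) → Dec (Primitive p x)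
primitive? p x = any? (λ i → ¬? (p ∣? toℕ (x i)))

solves? : ∀ {n m} (Q : Fin n → Fin n → ℤ) (t : ℤ) (x : Vector (Fin m) n) →
          Dec (qf Q x mod m ≡ t mod m)
solves? {m = m} Q t x = (qf Q x mod m) ≟ (t mod m)

A : ∀ {n} → ℕ → ℕ → (Fin n → Fin n → ℤ) → ℤ → ℕ
A {n} p k Q t = length (filter (solves? Q t) (allVecs n (p ℕ.^ k)))

B : ∀ {n} → ℕ → ℕ → (Fin n → Fin n → ℤ) → ℤ → ℕ
B {n} p k Q t =
  length (filter (primitive? p) (filter (solves? Q t) (allVecs n (p ℕ.^ k))))

C : ∀ {n} → ℕ → ℕ → (Fin n → Fin n → ℤ) → ℤ → ℕ
C {n} p k Q t =
  length (filter (λ x → ¬? (primitive? p x)) (filter (solves? Q t) (allVecs n (p ℕ.^ k))))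

-- If sym_{p^k}(t) = sym_{p^k}(s) then s ≡ v²t (mod p^k) for a unit v. Indeed, writing
-- t = p^e·a and s = p^e·b with p ∤ a, b, it suffices that b/a is a square modulo p^(k−e).
-- For odd p, equal Legendre symbols make b/a a square modulo p (two nonsquares differ by a
-- square factor, because i ↦ i² and i ↦ a·i² together exhaust ℤ/p), and Hensel's lemma lifts
-- the root; for p = 2, a ≡ b (mod 8) and the root of b/a modulo 8 lifts to every power of 2.
-- Multiplying coordinates by v permutes (ℤ/p^k)^n, preserves primitivity and turns solutions
-- of xᵀQx ≡ t into solutions of xᵀQx ≡ s, so the three counts agree.

module Submission where

open import Level using (0ℓ)
open import Function.Base using (_∘_)
open import Function.Bundles using (_⇔_; mk⇔; Equivalence)
open import Function.Definitions using (Injective)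
open import Data.Empty using (⊥-elim)
open import Data.Product using (_×_; _,_; proj₁; proj₂; ∃)
open import Data.Sum using (_⊎_; inj₁; inj₂; [_,_]′)
open import Data.Maybe.Properties using (just-injective)
open import Data.Nat as ℕ using (ℕ; zero; suc; NonZero; _≤_; _<_; _≥_; z≤n; s≤s)
import Data.Nat.Properties as ℕ
import Data.Nat.Divisibility as ℕ
open import Data.Nat.DivMod using (_%_; _/_; m%n<n; m≡m%n+[m/n]*n; m/n*n≡m; m/n<m)
open import Data.Nat.Primality
  using (Prime; euclidsLemma; prime⇒nonZero; prime⇒nonTrivial; prime⇒irreducible; prime[2])
open import Data.Nat.ListAction using (sum)
open import Data.Nat.ListAction.Properties using (sum-++)
open import Data.Integer as ℤ using (ℤ; +_; _%ℕ_; _/ℕ_)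
import Data.Integer.Properties as ℤ
open import Data.Integer.DivMod using (n%ℕd<d; a≡a%ℕn+[a/ℕn]*n)
open import Data.Integer.Divisibility.Signed as ℤ∣ using (divides; _∣_)
open import Data.Integer.Tactic.RingSolver using (solve-∀)
open import Data.Fin as Fin using (Fin; toℕ; fromℕ<)
import Data.Fin.Properties as Fin
open import Data.Fin.Permutation using (Permutation; permutation; _⟨$⟩ʳ_)
open import Data.List as List using (List; []; _∷_; length; filter; map; concatMap; allFin; tabulate)
open import Data.List.Properties using (map-++; map-tabulate; map-∘; map-cong)
open import Data.Vec.Functional using (Vector) renaming (_∷_ to _∷ᵥ_)
open import Algebra.Properties.CommutativeMonoid.Sum ℕ.+-0-commutativeMonoid
  using () renaming (sum to ∑ᶠ; sum-permute to ∑ᶠ-permute)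
open import Relation.Nullary using (¬_; yes; no; contradiction; _×-dec_; ¬?)
open import Relation.Unary using (Pred; Decidable)
open import Relation.Binary.Bundles using (Setoid)
open import Relation.Binary.PropositionalEquality as ≡
  using (_≡_; _≢_; refl; trans; cong; cong₂; subst; subst₂; module ≡-Reasoning)
open import Defs
  using (∑; ordAux; copAux; cop; ord; legendre; sgn; sym; _mod_; qf; allVecs; Primitive; primitive?; solves?; A; B; C)

-- Congruences modulo an integer

infix 4 _≡_[mod_]
record _≡_[mod_] (a b M : ℤ) : Set where
  constructor mk≡mod
  field divides-diff : M ∣ a ℤ.- b
open _≡_[mod_] public

≡-mod-refl : ∀ {M} a → a ≡ a [mod M ]
≡-mod-refl a = mk≡mod (divides (+ 0) (trans (ℤ.+-inverseʳ a) (≡.sym (ℤ.*-zeroˡ a))))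

≡⇒≡-mod : ∀ {M a b} → a ≡ b → a ≡ b [mod M ]
≡⇒≡-mod {a = a} refl = ≡-mod-refl a

≡-mod-sym : ∀ {M a b} → a ≡ b [mod M ] → b ≡ a [mod M ]
≡-mod-sym {a = a} {b} (mk≡mod d) = mk≡mod (subst (_ ∣_) (-[a-b]≡b-a a b) (ℤ∣.∣m⇒∣-m d))
  where
  -[a-b]≡b-a : ∀ a b → ℤ.- (a ℤ.- b) ≡ b ℤ.- a
  -[a-b]≡b-a = solve-∀

≡-mod-trans : ∀ {M a b c} → a ≡ b [mod M ] → b ≡ c [mod M ] → a ≡ c [mod M ]
≡-mod-trans {a = a} {b} {c} (mk≡mod d) (mk≡mod e) =
  mk≡mod (subst (_ ∣_) ([a-b]+[b-c]≡a-c a b c) (ℤ∣.∣m∣n⇒∣m+n d e))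
  where
  [a-b]+[b-c]≡a-c : ∀ a b c → (a ℤ.- b) ℤ.+ (b ℤ.- c) ≡ a ℤ.- c
  [a-b]+[b-c]≡a-c = solve-∀

≡-mod-setoid : ℤ → Setoid _ _
≡-mod-setoid M = record
  { Carrier = ℤ
  ; _≈_ = λ a b → a ≡ b [mod M ]
  ; isEquivalence = record
    { refl = ≡-mod-refl _ ; sym = ≡-mod-sym ; trans = ≡-mod-trans } }

module ≡-mod-Reasoning (M : ℤ) where
  open import Relation.Binary.Reasoning.Setoid (≡-mod-setoid M) public

+-cong-mod : ∀ {M a b c d} → a ≡ b [mod M ] → c ≡ d [mod M ] → a ℤ.+ c ≡ b ℤ.+ d [mod M ]
+-cong-mod {a = a} {b} {c} {d} (mk≡mod x) (mk≡mod y) =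
  mk≡mod (subst (_ ∣_) ([a-b]+[c-d]≡[a+c]-[b+d] a b c d) (ℤ∣.∣m∣n⇒∣m+n x y))
  where
  [a-b]+[c-d]≡[a+c]-[b+d] : ∀ a b c d → (a ℤ.- b) ℤ.+ (c ℤ.- d) ≡ (a ℤ.+ c) ℤ.- (b ℤ.+ d)
  [a-b]+[c-d]≡[a+c]-[b+d] = solve-∀

*-cong-mod : ∀ {M a b c d} → a ≡ b [mod M ] → c ≡ d [mod M ] → a ℤ.* c ≡ b ℤ.* d [mod M ]
*-cong-mod {a = a} {b} {c} {d} (mk≡mod x) (mk≡mod y) =
  mk≡mod (subst (_ ∣_) ([a-b]c+b[c-d]≡ac-bd a b c d) (ℤ∣.∣m∣n⇒∣m+n (ℤ∣.∣m⇒∣m*n c x) (ℤ∣.∣n⇒∣m*n b y)))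
  where
  [a-b]c+b[c-d]≡ac-bd : ∀ a b c d → (a ℤ.- b) ℤ.* c ℤ.+ b ℤ.* (c ℤ.- d) ≡ a ℤ.* c ℤ.- b ℤ.* d
  [a-b]c+b[c-d]≡ac-bd = solve-∀

*-congˡ-mod : ∀ {M a b} c → a ≡ b [mod M ] → c ℤ.* a ≡ c ℤ.* b [mod M ]
*-congˡ-mod c = *-cong-mod (≡-mod-refl c)

≡-mod-∣ : ∀ {M N a b} → M ∣ N → a ≡ b [mod N ] → a ≡ b [mod M ]
≡-mod-∣ M∣N (mk≡mod d) = mk≡mod (ℤ∣.∣-trans M∣N d)

≡-mod-respects-∣ : ∀ {M a b} → a ≡ b [mod M ] → M ∣ a → M ∣ b
≡-mod-respects-∣ {a = a} {b} (mk≡mod d) M∣a = subst (_ ∣_) (a-[a-b]≡b a b) (ℤ∣.∣m∣n⇒∣m-n M∣a d)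
  where
  a-[a-b]≡b : ∀ a b → a ℤ.- (a ℤ.- b) ≡ b
  a-[a-b]≡b = solve-∀

c*a-c*b≡c*[a-b] : ∀ c a b → c ℤ.* a ℤ.- c ℤ.* b ≡ c ℤ.* (a ℤ.- b)
c*a-c*b≡c*[a-b] = solve-∀

*-scale-mod : ∀ {M a b} c → a ≡ b [mod M ] → c ℤ.* a ≡ c ℤ.* b [mod c ℤ.* M ]
*-scale-mod {M} {a} {b} c (mk≡mod (divides d a-b≡dM)) = mk≡mod (divides d (begin
  c ℤ.* a ℤ.- c ℤ.* b   ≡⟨ c*a-c*b≡c*[a-b] c a b ⟩
  c ℤ.* (a ℤ.- b)       ≡⟨ cong (c ℤ.*_) a-b≡dM ⟩
  c ℤ.* (d ℤ.* M)       ≡⟨ swap c d M ⟩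
  d ℤ.* (c ℤ.* M)       ∎))
  where
  open ≡-Reasoning
  swap : ∀ c d M → c ℤ.* (d ℤ.* M) ≡ d ℤ.* (c ℤ.* M)
  swap = solve-∀

≡-mod-1 : ∀ a b → a ≡ b [mod + 1 ]
≡-mod-1 a b = mk≡mod (divides (a ℤ.- b) (≡.sym (ℤ.*-identityʳ _)))

i≡i%ℕm-mod : ∀ i m .{{_ : NonZero m}} → i ≡ + (i %ℕ m) [mod + m ]
i≡i%ℕm-mod i m = mk≡mod (divides (i /ℕ m) (begin
  i ℤ.- + (i %ℕ m)                              ≡⟨ cong (ℤ._- + (i %ℕ m)) (a≡a%ℕn+[a/ℕn]*n i m) ⟩
  + (i %ℕ m) ℤ.+ i /ℕ m ℤ.* + m ℤ.- + (i %ℕ m)  ≡⟨ r+q-r≡q (+ (i %ℕ m)) (i /ℕ m ℤ.* + m) ⟩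
  i /ℕ m ℤ.* + m                                ∎))
  where
  open ≡-Reasoning
  r+q-r≡q : ∀ r q → r ℤ.+ q ℤ.- r ≡ q
  r+q-r≡q = solve-∀

n≡n%m-mod : ∀ n m .{{_ : NonZero m}} → + n ≡ + (n % m) [mod + m ]
n≡n%m-mod n = i≡i%ℕm-mod (+ n)

m∣n<m⇒n≡0 : ∀ {m n} → m ℕ.∣ n → n < m → n ≡ 0
m∣n<m⇒n≡0 {n = zero}  _   _   = refl
m∣n<m⇒n≡0 {n = suc n} m∣n n<m = ⊥-elim (ℕ.<⇒≱ n<m (ℕ.∣⇒≤ m∣n))

≡-mod-≤-<⇒≡ : ∀ {m x y} → x ≤ y → y < m → + y ≡ + x [mod + m ] → x ≡ y
≡-mod-≤-<⇒≡ {m} {x} {y} x≤y y<m (mk≡mod m∣y-x) =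
  ℕ.≤-antisym x≤y (ℕ.m∸n≡0⇒m≤n y∸x≡0)
  where
  ∣y-x∣≡y∸x : ℤ.∣ + y ℤ.- + x ∣ ≡ y ℕ.∸ x
  ∣y-x∣≡y∸x = trans (cong ℤ.∣_∣ (ℤ.m-n≡m⊖n y x)) (trans (ℤ.∣m⊖n∣≡∣n⊖m∣ y x) (ℤ.∣⊖∣-≤ x≤y))
  y∸x≡0 : y ℕ.∸ x ≡ 0
  y∸x≡0 = m∣n<m⇒n≡0 (subst (m ℕ.∣_) ∣y-x∣≡y∸x (ℤ∣.∣⇒∣ᵤ m∣y-x))
                    (ℕ.≤-<-trans (ℕ.m∸n≤m y x) y<m)

≡-mod-<⇒≡ : ∀ {m x y} → x < m → y < m → + x ≡ + y [mod + m ] → x ≡ y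
≡-mod-<⇒≡ {x = x} {y} x<m y<m x≡y with ℕ.≤-total x y
... | inj₁ x≤y = ≡-mod-≤-<⇒≡ x≤y y<m (≡-mod-sym x≡y)
... | inj₂ y≤x = ≡.sym (≡-mod-≤-<⇒≡ y≤x x<m x≡y)

%-≡⇒≡-mod : ∀ {m} .{{_ : NonZero m}} {x y} → x % m ≡ y % m → + x ≡ + y [mod + m ]
%-≡⇒≡-mod {m} {x} {y} eq = begin
  + x       ≈⟨ n≡n%m-mod x m ⟩
  + (x % m) ≡⟨ cong +_ eq ⟩
  + (y % m) ≈⟨ n≡n%m-mod y m ⟨
  + y       ∎
  where open ≡-mod-Reasoning (+ m)

≡-mod⇒%-≡ : ∀ {m} .{{_ : NonZero m}} {x y} → + x ≡ + y [mod + m ] → x % m ≡ y % m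
≡-mod⇒%-≡ {m} {x} {y} x≡y = ≡-mod-<⇒≡ (m%n<n x m) (m%n<n y m) (begin
  + (x % m) ≈⟨ n≡n%m-mod x m ⟨
  + x       ≈⟨ x≡y ⟩
  + y       ≈⟨ n≡n%m-mod y m ⟩
  + (y % m) ∎)
  where open ≡-mod-Reasoning (+ m)

mod≡%ℕ : ∀ m .{{_ : NonZero m}} i → i mod m ≡ i %ℕ m
mod≡%ℕ (suc m) i = refl

mod-< : ∀ m .{{_ : NonZero m}} i → i mod m < m
mod-< m i = subst (_< m) (≡.sym (mod≡%ℕ m i)) (n%ℕd<d i m)

i≡i-mod-m : ∀ m .{{_ : NonZero m}} i → i ≡ + (i mod m) [mod + m ]
i≡i-mod-m m i = ≡-mod-trans (i≡i%ℕm-mod i m) (≡⇒≡-mod (cong +_ (≡.sym (mod≡%ℕ m i))))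

mod-≡⇒≡-mod : ∀ m .{{_ : NonZero m}} i j → i mod m ≡ j mod m → i ≡ j [mod + m ]
mod-≡⇒≡-mod m i j eq = begin
  i              ≈⟨ i≡i-mod-m m i ⟩
  + (i mod m)    ≡⟨ cong +_ eq ⟩
  + (j mod m)    ≈⟨ i≡i-mod-m m j ⟨
  j              ∎
  where open ≡-mod-Reasoning (+ m)

≡-mod⇒mod-≡ : ∀ m .{{_ : NonZero m}} i j → i ≡ j [mod + m ] → i mod m ≡ j mod m
≡-mod⇒mod-≡ m i j i≡j = ≡-mod-<⇒≡ (mod-< m i) (mod-< m j) (begin
  + (i mod m)    ≈⟨ i≡i-mod-m m i ⟨
  i              ≈⟨ i≡j ⟩
  j              ≈⟨ i≡i-mod-m m j ⟩
  + (j mod m)    ∎)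
  where open ≡-mod-Reasoning (+ m)

reduceMod : ∀ m .{{_ : NonZero m}} → ℕ → Fin m
reduceMod m u = fromℕ< (m%n<n u m)

reduceMod-≡-mod : ∀ m .{{_ : NonZero m}} u → + toℕ (reduceMod m u) ≡ + u [mod + m ]
reduceMod-≡-mod m u =
  ≡-mod-trans (≡⇒≡-mod (cong +_ (Fin.toℕ-fromℕ< (m%n<n u m)))) (≡-mod-sym (n≡n%m-mod u m))

reduceMod-≡⇒≡-mod : ∀ m .{{_ : NonZero m}} {u w} → reduceMod m u ≡ reduceMod m w → + u ≡ + w [mod + m ]
reduceMod-≡⇒≡-mod m {u} {w} eq = begin
  + u                      ≈⟨ reduceMod-≡-mod m u ⟨
  + toℕ (reduceMod m u)    ≡⟨ cong (λ i → + toℕ i) eq ⟩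
  + toℕ (reduceMod m w)    ≈⟨ reduceMod-≡-mod m w ⟩
  + w                      ∎
  where open ≡-mod-Reasoning (+ m)

injective⇒surjective : ∀ {n} (f : Fin n → Fin n) → Injective _≡_ _≡_ f → ∀ b → ∃ λ a → f a ≡ b
injective⇒surjective {zero}  f f-inj ()
injective⇒surjective {suc n} f f-inj b with Fin.any? (λ a → f a Fin.≟ b)
... | yes hit = hit
... | no miss = ⊥-elim (ℕ.<-irrefl refl (Fin.injective⇒≤ punchOut-b∘f-injective))
  where
  b≢f : ∀ a → b ≢ f a
  b≢f a b≡fa = miss (a , ≡.sym b≡fa)
  punchOut-b∘f-injective : Injective _≡_ _≡_ (λ a → Fin.punchOut (b≢f a))
  punchOut-b∘f-injective eq = f-inj (Fin.punchOut-injective (b≢f _) (b≢f _) eq)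

-- Units and squares modulo prime powers

SquareMod : ℕ → ℕ → Set
SquareMod m a = ∃ λ x → + x ℤ.* + x ≡ + a [mod + m ]

UnitSquareRatio : ℕ → ℤ → ℤ → ℤ → Set
UnitSquareRatio p M A B = ∃ λ v → ¬ (+ p ∣ v) × v ℤ.* v ℤ.* A ≡ B [mod M ]

module _ {p : ℕ} (p-prime : Prime p) where

  private instance
    p≢0 : NonZero p
    p≢0 = prime⇒nonZero p-prime

  euclidsLemmaℤ : ∀ a b → + p ∣ a ℤ.* b → + p ∣ a ⊎ + p ∣ b
  euclidsLemmaℤ a b p∣ab
    with euclidsLemma ℤ.∣ a ∣ ℤ.∣ b ∣ p-prime (subst (p ℕ.∣_) (ℤ.abs-* a b) (ℤ∣.∣⇒∣ᵤ p∣ab))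
  ... | inj₁ p∣a = inj₁ (ℤ∣.∣ᵤ⇒∣ p∣a)
  ... | inj₂ p∣b = inj₂ (ℤ∣.∣ᵤ⇒∣ p∣b)

  p∤a∧p∤b⇒p∤ab : ∀ {a b} → ¬ (+ p ∣ a) → ¬ (+ p ∣ b) → ¬ (+ p ∣ a ℤ.* b)
  p∤a∧p∤b⇒p∤ab {a} {b} p∤a p∤b p∣ab = [ p∤a , p∤b ]′ (euclidsLemmaℤ a b p∣ab)

  p∣p^[1+k] : ∀ k → + p ∣ + (p ℕ.^ suc k)
  p∣p^[1+k] k = divides (+ (p ℕ.^ k)) (trans (ℤ.pos-* p (p ℕ.^ k)) (ℤ.*-comm (+ p) _))

  p∣p^k : ∀ {k} → 1 ≤ k → + p ∣ + (p ℕ.^ k)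
  p∣p^k {suc k} _ = p∣p^[1+k] k

  p^k∣ab∧p∤a⇒p^k∣b : ∀ k {a b} → ¬ (+ p ∣ a) → + (p ℕ.^ k) ∣ a ℤ.* b → + (p ℕ.^ k) ∣ b
  p^k∣ab∧p∤a⇒p^k∣b zero    {b = b} _ _ = divides b (≡.sym (ℤ.*-identityʳ b))
  p^k∣ab∧p∤a⇒p^k∣b (suc k) {a} p∤a p^[1+k]∣ab
    with p^k∣ab∧p∤a⇒p^k∣b k p∤a (ℤ∣.∣-trans p^k∣p^[1+k] p^[1+k]∣ab)
    where
    p^k∣p^[1+k] : + (p ℕ.^ k) ∣ + (p ℕ.^ suc k)
    p^k∣p^[1+k] = divides (+ p) (ℤ.pos-* p (p ℕ.^ k))
  ... | divides s refl = subst (_∣ s ℤ.* p^k) (≡.sym p^[1+k]≡p*p^k) (ℤ∣.*-monoˡ-∣ p^k p∣s)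
    where
    p^k = + (p ℕ.^ k)
    p^[1+k]≡p*p^k : + (p ℕ.^ suc k) ≡ + p ℤ.* p^k
    p^[1+k]≡p*p^k = ℤ.pos-* p (p ℕ.^ k)
    p∣as : + p ∣ a ℤ.* s
    p∣as = ℤ∣.*-cancelʳ-∣ p^k {{ℕ.m^n≢0 p k}}
      (subst₂ _∣_ p^[1+k]≡p*p^k (≡.sym (ℤ.*-assoc a s p^k)) p^[1+k]∣ab)
    p∣s : + p ∣ s
    p∣s = [ (λ p∣a → ⊥-elim (p∤a p∣a)) , (λ p∣s → p∣s) ]′ (euclidsLemmaℤ a s p∣as)

  *-cancelˡ-mod : ∀ k {c a b} → ¬ (+ p ∣ c) →
    c ℤ.* a ≡ c ℤ.* b [mod + (p ℕ.^ k) ] → a ≡ b [mod + (p ℕ.^ k) ]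
  *-cancelˡ-mod k {c} {a} {b} p∤c (mk≡mod d) =
    mk≡mod (p^k∣ab∧p∤a⇒p^k∣b k p∤c (subst (_ ∣_) (c*a-c*b≡c*[a-b] c a b) d))

  module _ (k : ℕ) where

    private instance
      p^k≢0 : NonZero (p ℕ.^ k)
      p^k≢0 = ℕ.m^n≢0 p k

    scaleMod : ℕ → Fin (p ℕ.^ k) → Fin (p ℕ.^ k)
    scaleMod v a = reduceMod (p ℕ.^ k) (v ℕ.* toℕ a)

    scaleMod-≡-mod : ∀ v a → + toℕ (scaleMod v a) ≡ + v ℤ.* + toℕ a [mod + (p ℕ.^ k) ]
    scaleMod-≡-mod v a = ≡-mod-trans (reduceMod-≡-mod (p ℕ.^ k) (v ℕ.* toℕ a)) (≡⇒≡-mod (ℤ.pos-* v (toℕ a)))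

    scaleMod-injective : ∀ {v} → ¬ (+ p ∣ + v) → Injective _≡_ _≡_ (scaleMod v)
    scaleMod-injective {v} p∤v {a} {b} va≡vb =
      Fin.toℕ-injective (≡-mod-<⇒≡ (Fin.toℕ<n a) (Fin.toℕ<n b) (*-cancelˡ-mod k p∤v (begin
        + v ℤ.* + toℕ a        ≈⟨ scaleMod-≡-mod v a ⟨
        + toℕ (scaleMod v a)   ≡⟨ cong (λ c → + toℕ c) va≡vb ⟩
        + toℕ (scaleMod v b)   ≈⟨ scaleMod-≡-mod v b ⟩
        + v ℤ.* + toℕ b        ∎)))
      where open ≡-mod-Reasoning (+ (p ℕ.^ k))

    scaleMod-permutation : ∀ {v} → ¬ (+ p ∣ + v) → Permutation (p ℕ.^ k) (p ℕ.^ k)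
    scaleMod-permutation {v} p∤v = permutation (scaleMod v) (λ b → proj₁ (onto b))
      (λ b → proj₂ (onto b)) (λ a → scaleMod-injective p∤v (proj₂ (onto (scaleMod v a))))
      where
      onto = injective⇒surjective (scaleMod v) (scaleMod-injective p∤v)

    ∃-inverse-mod : ∀ {v} → ¬ (+ p ∣ + v) → ∃ λ w → + v ℤ.* + w ≡ + 1 [mod + (p ℕ.^ k) ]
    ∃-inverse-mod {v} p∤v = toℕ a , (begin
      + v ℤ.* + toℕ a                   ≈⟨ scaleMod-≡-mod v a ⟨
      + toℕ (scaleMod v a)              ≡⟨ cong (λ c → + toℕ c) va≡1 ⟩
      + toℕ (reduceMod (p ℕ.^ k) 1)     ≈⟨ reduceMod-≡-mod (p ℕ.^ k) 1 ⟩
      + 1                               ∎)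
      where
      open ≡-mod-Reasoning (+ (p ℕ.^ k))
      preimage = injective⇒surjective (scaleMod v) (scaleMod-injective p∤v) (reduceMod (p ℕ.^ k) 1)
      a = proj₁ preimage
      va≡1 = proj₂ preimage

    ∣scaleMod⇔∣ : 1 ≤ k → ∀ {v} → ¬ (+ p ∣ + v) → ∀ a → p ℕ.∣ toℕ (scaleMod v a) ⇔ p ℕ.∣ toℕ a
    ∣scaleMod⇔∣ 1≤k {v} p∤v a = mk⇔
      (λ p∣va → [ (λ p∣v → ⊥-elim (p∤v p∣v)) , ℤ∣.∣⇒∣ᵤ ]′
                  (euclidsLemmaℤ (+ v) (+ toℕ a) (≡-mod-respects-∣ va≡v*a (ℤ∣.∣ᵤ⇒∣ p∣va))))
      (λ p∣a → ℤ∣.∣⇒∣ᵤ (≡-mod-respects-∣ (≡-mod-sym va≡v*a) (ℤ∣.∣n⇒∣m*n (+ v) (ℤ∣.∣ᵤ⇒∣ p∣a))))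
      where
      va≡v*a : + toℕ (scaleMod v a) ≡ + v ℤ.* + toℕ a [mod + p ]
      va≡v*a = ≡-mod-∣ (p∣p^k 1≤k) (scaleMod-≡-mod v a)

  ∃-inverse-mod-p : ∀ x → ¬ (+ p ∣ x) → ∃ λ w → x ℤ.* + w ≡ + 1 [mod + p ]
  ∃-inverse-mod-p x p∤x = w , (begin
    x ℤ.* + w            ≈⟨ *-cong-mod (i≡i%ℕm-mod x p) (≡-mod-refl (+ w)) ⟩
    + (x %ℕ p) ℤ.* + w   ≈⟨ ≡-mod-∣ (p∣p^[1+k] 0) (proj₂ inverse) ⟩
    + 1                  ∎)
    where
    open ≡-mod-Reasoning (+ p)
    p∤x%p : ¬ (+ p ∣ + (x %ℕ p))
    p∤x%p p∣x%p = p∤x (≡-mod-respects-∣ (≡-mod-sym (i≡i%ℕm-mod x p)) p∣x%p)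
    inverse = ∃-inverse-mod 1 p∤x%p
    w = proj₁ inverse

  p∤n : ∀ {n} → 1 ≤ n → n < p → ¬ (+ p ∣ + n)
  p∤n {n} 1≤n n<p p∣n = ℕ.<⇒≱ n<p (ℕ.∣⇒≤ {{ℕ.>-nonZero 1≤n}} (ℤ∣.∣⇒∣ᵤ p∣n))

  p∤1 : ¬ (+ p ∣ + 1)
  p∤1 = p∤n ℕ.≤-refl (ℕ.nonTrivial⇒n>1 p {{prime⇒nonTrivial p-prime}})

  *-cancelˡ-mod-p : ∀ {c a b} → ¬ (+ p ∣ c) → c ℤ.* a ≡ c ℤ.* b [mod + p ] → a ≡ b [mod + p ]
  *-cancelˡ-mod-p {c} {a} {b} p∤c (mk≡mod d) =
    [ (λ p∣c → ⊥-elim (p∤c p∣c)) , mk≡mod ]′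
      (euclidsLemmaℤ c (a ℤ.- b) (subst (_ ∣_) (c*a-c*b≡c*[a-b] c a b) d))

  square-of-square-ratio : ∀ {a c s} → ¬ (+ p ∣ + s) →
    + c ℤ.* + c ≡ + a ℤ.* (+ s ℤ.* + s) [mod + p ] → SquareMod p a
  square-of-square-ratio {a} {c} {s} p∤s c²≡as² = c ℕ.* w , (begin
    + (c ℕ.* w) ℤ.* + (c ℕ.* w)                 ≡⟨ cong₂ ℤ._*_ (ℤ.pos-* c w) (ℤ.pos-* c w) ⟩
    (+ c ℤ.* + w) ℤ.* (+ c ℤ.* + w)             ≡⟨ regroup₁ (+ c) (+ w) ⟩
    (+ c ℤ.* + c) ℤ.* (+ w ℤ.* + w)             ≈⟨ *-cong-mod c²≡as² (≡-mod-refl _) ⟩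
    + a ℤ.* (+ s ℤ.* + s) ℤ.* (+ w ℤ.* + w)     ≡⟨ regroup₂ (+ a) (+ s) (+ w) ⟩
    + a ℤ.* ((+ s ℤ.* + w) ℤ.* (+ s ℤ.* + w))   ≈⟨ *-congˡ-mod (+ a) (*-cong-mod sw≡1 sw≡1) ⟩
    + a ℤ.* (+ 1 ℤ.* + 1)                       ≡⟨ ℤ.*-identityʳ (+ a) ⟩
    + a                                         ∎)
    where
    open ≡-mod-Reasoning (+ p)
    inverse = ∃-inverse-mod-p (+ s) p∤s
    w = proj₁ inverse
    sw≡1 = proj₂ inverse
    regroup₁ : ∀ c w → (c ℤ.* w) ℤ.* (c ℤ.* w) ≡ (c ℤ.* c) ℤ.* (w ℤ.* w)
    regroup₁ = solve-∀
    regroup₂ : ∀ a s w → a ℤ.* (s ℤ.* s) ℤ.* (w ℤ.* w) ≡ a ℤ.* ((s ℤ.* w) ℤ.* (s ℤ.* w))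
    regroup₂ = solve-∀

  module _ {h : ℕ} (p≡1+2h : p ≡ suc (h ℕ.+ h)) where

    ≤h⇒<p : ∀ {x} → x ≤ h → x < p
    ≤h⇒<p {x} x≤h = subst (x <_) (≡.sym p≡1+2h) (s≤s (ℕ.≤-trans x≤h (ℕ.m≤m+n h h)))

    squares-injective : ∀ {x y} → x ≤ h → y ≤ h → + x ℤ.* + x ≡ + y ℤ.* + y [mod + p ] → x ≡ y
    squares-injective {x} {y} x≤h y≤h (mk≡mod p∣x²-y²) =
      [ (λ p∣x-y → ≡-mod-<⇒≡ (≤h⇒<p x≤h) (≤h⇒<p y≤h) (mk≡mod p∣x-y)) , p∣x+y⇒x≡y ]′
        (euclidsLemmaℤ (+ x ℤ.- + y) (+ x ℤ.+ + y)
          (subst (+ p ∣_) (x²-y²≡[x-y][x+y] (+ x) (+ y)) p∣x²-y²))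
      where
      x²-y²≡[x-y][x+y] : ∀ x y → x ℤ.* x ℤ.- y ℤ.* y ≡ (x ℤ.- y) ℤ.* (x ℤ.+ y)
      x²-y²≡[x-y][x+y] = solve-∀
      x+y<p : x ℕ.+ y < p
      x+y<p = subst (x ℕ.+ y <_) (≡.sym p≡1+2h) (s≤s (ℕ.+-mono-≤ x≤h y≤h))
      p∣x+y⇒x≡y : + p ∣ + x ℤ.+ + y → x ≡ y
      p∣x+y⇒x≡y p∣x+y = trans (ℕ.m+n≡0⇒m≡0 x x+y≡0) (≡.sym (ℕ.m+n≡0⇒n≡0 x x+y≡0))
        where
        x+y≡0 : x ℕ.+ y ≡ 0
        x+y≡0 = ≡-mod-<⇒≡ x+y<p (ℕ.≤-<-trans z≤n x+y<p)
          (mk≡mod (subst (+ p ∣_) (trans (ℤ.pos-+ x y) (≡.sym (ℤ.+-identityʳ _))) p∣x+y))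

    module _ {a : ℕ} (p∤a : ¬ (+ p ∣ + a)) (a-nonsquare : ¬ SquareMod p a) where

      shift : ℕ → ℕ
      shift n = n ℕ.∸ h

      squareOrScaledSquare : Fin p → Fin p
      squareOrScaledSquare i with toℕ i ℕ.≤? h
      ... | yes _ = reduceMod p (toℕ i ℕ.* toℕ i)
      ... | no _  = reduceMod p (a ℕ.* (shift (toℕ i) ℕ.* shift (toℕ i)))

      1≤shift : ∀ {n} → ¬ (n ≤ h) → 1 ≤ shift n
      1≤shift n≰h = ℕ.m<n⇒0<n∸m (ℕ.≰⇒> n≰h)

      shift≤h : ∀ (i : Fin p) → shift (toℕ i) ≤ h
      shift≤h i = subst (shift (toℕ i) ≤_) (ℕ.m+n∸n≡m h h)
        (ℕ.∸-monoˡ-≤ h (ℕ.≤-pred (subst (toℕ i <_) p≡1+2h (Fin.toℕ<n i))))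

      shift-injective : ∀ {m n} → ¬ (m ≤ h) → ¬ (n ≤ h) → shift m ≡ shift n → m ≡ n
      shift-injective m≰h n≰h eq = trans (≡.sym (ℕ.m∸n+n≡m (ℕ.<⇒≤ (ℕ.≰⇒> m≰h))))
        (trans (cong (ℕ._+ h) eq) (ℕ.m∸n+n≡m (ℕ.<⇒≤ (ℕ.≰⇒> n≰h))))

      reduceMod-≡⇒≡-mod-via : ∀ {u w U W} → + u ≡ U → + w ≡ W →
        reduceMod p u ≡ reduceMod p w → U ≡ W [mod + p ]
      reduceMod-≡⇒≡-mod-via refl refl = reduceMod-≡⇒≡-mod p

      pos-scaled : ∀ y → + (a ℕ.* (y ℕ.* y)) ≡ + a ℤ.* (+ y ℤ.* + y)
      pos-scaled y = trans (ℤ.pos-* a (y ℕ.* y)) (cong (+ a ℤ.*_) (ℤ.pos-* y y))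

      square≢scaled : ∀ x {y} → 1 ≤ y → y ≤ h → ¬ (+ x ℤ.* + x ≡ + a ℤ.* (+ y ℤ.* + y) [mod + p ])
      square≢scaled x 1≤y y≤h x²≡ay² =
        a-nonsquare (square-of-square-ratio {c = x} (p∤n 1≤y (≤h⇒<p y≤h)) x²≡ay²)

      squareOrScaledSquare-injective : Injective _≡_ _≡_ squareOrScaledSquare
      squareOrScaledSquare-injective {i} {j} eq with toℕ i ℕ.≤? h | toℕ j ℕ.≤? h
      ... | yes i≤h | yes j≤h = Fin.toℕ-injective (squares-injective i≤h j≤h
        (reduceMod-≡⇒≡-mod-via (ℤ.pos-* (toℕ i) (toℕ i)) (ℤ.pos-* (toℕ j) (toℕ j)) eq))
      ... | no i≰h  | no j≰h  = Fin.toℕ-injective (shift-injective i≰h j≰h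
        (squares-injective (shift≤h i) (shift≤h j)
          (*-cancelˡ-mod-p p∤a
            (reduceMod-≡⇒≡-mod-via (pos-scaled (shift (toℕ i))) (pos-scaled (shift (toℕ j))) eq))))
      ... | yes i≤h | no j≰h  = ⊥-elim (square≢scaled (toℕ i) (1≤shift j≰h) (shift≤h j)
        (reduceMod-≡⇒≡-mod-via (ℤ.pos-* (toℕ i) (toℕ i)) (pos-scaled (shift (toℕ j))) eq))
      ... | no i≰h  | yes j≤h = ⊥-elim (square≢scaled (toℕ j) (1≤shift i≰h) (shift≤h i)
        (reduceMod-≡⇒≡-mod-via (ℤ.pos-* (toℕ j) (toℕ j)) (pos-scaled (shift (toℕ i))) (≡.sym eq)))

      nonsquare⇒scaled-square : ∀ {b} → ¬ SquareMod p b →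
        ∃ λ z → ¬ (+ p ∣ + z) × + a ℤ.* (+ z ℤ.* + z) ≡ + b [mod + p ]
      nonsquare⇒scaled-square {b} b-nonsquare =
        preimage (injective⇒surjective squareOrScaledSquare squareOrScaledSquare-injective (reduceMod p b))
        where
        preimage : ∃ (λ i → squareOrScaledSquare i ≡ reduceMod p b) →
          ∃ λ z → ¬ (+ p ∣ + z) × + a ℤ.* (+ z ℤ.* + z) ≡ + b [mod + p ]
        preimage (i , eq) with toℕ i ℕ.≤? h
        ... | yes _   = ⊥-elim (b-nonsquare (toℕ i , reduceMod-≡⇒≡-mod-via (ℤ.pos-* (toℕ i) (toℕ i)) refl eq))
        ... | no i≰h = shift (toℕ i) , p∤n (1≤shift i≰h) (≤h⇒<p (shift≤h i)) ,
                        reduceMod-≡⇒≡-mod-via (pos-scaled (shift (toℕ i))) refl eq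

    same-squareness⇒unit-square-ratio : ∀ {a b} → ¬ (+ p ∣ + a) → ¬ (+ p ∣ + b) →
      SquareMod p a × SquareMod p b ⊎ ¬ SquareMod p a × ¬ SquareMod p b →
      UnitSquareRatio p (+ p) (+ a) (+ b)
    same-squareness⇒unit-square-ratio {a} {b} p∤a p∤b (inj₁ ((x , x²≡a) , (y , y²≡b))) =
      + y ℤ.* + w , p∤a∧p∤b⇒p∤ab p∤y p∤w , (begin
      (+ y ℤ.* + w) ℤ.* (+ y ℤ.* + w) ℤ.* + a           ≈⟨ *-congˡ-mod ((+ y ℤ.* + w) ℤ.* (+ y ℤ.* + w)) x²≡a ⟨
      (+ y ℤ.* + w) ℤ.* (+ y ℤ.* + w) ℤ.* (+ x ℤ.* + x) ≡⟨ regroup (+ y) (+ w) (+ x) ⟩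
      (+ y ℤ.* + y) ℤ.* ((+ x ℤ.* + w) ℤ.* (+ x ℤ.* + w)) ≈⟨ *-congˡ-mod (+ y ℤ.* + y) (*-cong-mod xw≡1 xw≡1) ⟩
      (+ y ℤ.* + y) ℤ.* (+ 1 ℤ.* + 1)                   ≡⟨ ℤ.*-identityʳ (+ y ℤ.* + y) ⟩
      + y ℤ.* + y                                       ≈⟨ y²≡b ⟩
      + b                                               ∎)
      where
      open ≡-mod-Reasoning (+ p)
      p∤x : ¬ (+ p ∣ + x)
      p∤x p∣x = p∤a (≡-mod-respects-∣ x²≡a (ℤ∣.∣m⇒∣m*n (+ x) p∣x))
      p∤y : ¬ (+ p ∣ + y)
      p∤y p∣y = p∤b (≡-mod-respects-∣ y²≡b (ℤ∣.∣m⇒∣m*n (+ y) p∣y))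
      inverse = ∃-inverse-mod-p (+ x) p∤x
      w = proj₁ inverse
      xw≡1 = proj₂ inverse
      p∤w : ¬ (+ p ∣ + w)
      p∤w p∣w = p∤1 (≡-mod-respects-∣ xw≡1 (ℤ∣.∣n⇒∣m*n (+ x) p∣w))
      regroup : ∀ y w x → (y ℤ.* w) ℤ.* (y ℤ.* w) ℤ.* (x ℤ.* x) ≡ (y ℤ.* y) ℤ.* ((x ℤ.* w) ℤ.* (x ℤ.* w))
      regroup = solve-∀
    same-squareness⇒unit-square-ratio {a} {b} p∤a p∤b (inj₂ (a-nonsquare , b-nonsquare))
      with nonsquare⇒scaled-square p∤a a-nonsquare b-nonsquare
    ... | z , p∤z , az²≡b = + z , p∤z , ≡-mod-trans (≡⇒≡-mod (regroup (+ z) (+ a))) az²≡b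
      where
      regroup : ∀ z a → z ℤ.* z ℤ.* a ≡ a ℤ.* (z ℤ.* z)
      regroup = solve-∀

  -- Newton step: for u ≡ (2vA)⁻¹ (mod p) and v²A − B = dM, the correction v − duM is exact modulo pM.
  hensel-step : ∀ {M A B v} → + p ∣ M → ¬ (+ p ∣ + 2 ℤ.* v ℤ.* A) →
    v ℤ.* v ℤ.* A ≡ B [mod M ] →
    ∃ λ v′ → v′ ≡ v [mod M ] × v′ ℤ.* v′ ℤ.* A ≡ B [mod + p ℤ.* M ]
  hensel-step {A = A} {B} {v} (divides m refl) p∤2vA (mk≡mod (divides d vvA-B≡dM)) =
    v′ , mk≡mod (divides (ℤ.- (d ℤ.* + u)) (displacement v d (+ u) M)) , mk≡mod (divides q (begin
      v′ ℤ.* v′ ℤ.* A ℤ.- B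
        ≡⟨ expand v A B d (+ u) e m (+ p) ⟩
      (v ℤ.* v ℤ.* A ℤ.- B ℤ.- d ℤ.* M) ℤ.- d ℤ.* M ℤ.* (+ 2 ℤ.* v ℤ.* A ℤ.* + u ℤ.- + 1 ℤ.- e ℤ.* + p)
        ℤ.+ q ℤ.* (+ p ℤ.* M)
        ≡⟨ cong₂ (λ z₁ z₂ → z₁ ℤ.- d ℤ.* M ℤ.* z₂ ℤ.+ q ℤ.* (+ p ℤ.* M))
                 (ℤ.i≡j⇒i-j≡0 vvA-B≡dM) (ℤ.i≡j⇒i-j≡0 2vAu-1≡ep) ⟩
      + 0 ℤ.- d ℤ.* M ℤ.* + 0 ℤ.+ q ℤ.* (+ p ℤ.* M)
        ≡⟨ collapse (d ℤ.* M) (q ℤ.* (+ p ℤ.* M)) ⟩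
      q ℤ.* (+ p ℤ.* M) ∎))
    where
    open ≡-Reasoning
    M = m ℤ.* + p
    inverse = ∃-inverse-mod-p (+ 2 ℤ.* v ℤ.* A) p∤2vA
    u = proj₁ inverse
    e = ℤ∣._∣_.quotient (divides-diff (proj₂ inverse))
    2vAu-1≡ep : + 2 ℤ.* v ℤ.* A ℤ.* + u ℤ.- + 1 ≡ e ℤ.* + p
    2vAu-1≡ep = ℤ∣._∣_.equality (divides-diff (proj₂ inverse))
    v′ = v ℤ.- d ℤ.* + u ℤ.* M
    q = d ℤ.* + u ℤ.* (d ℤ.* + u) ℤ.* A ℤ.* m ℤ.- d ℤ.* e
    displacement : ∀ v d u M → v ℤ.- d ℤ.* u ℤ.* M ℤ.- v ≡ ℤ.- (d ℤ.* u) ℤ.* M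
    displacement = solve-∀
    expand : ∀ v A B d u e m p →
      (v ℤ.- d ℤ.* u ℤ.* (m ℤ.* p)) ℤ.* (v ℤ.- d ℤ.* u ℤ.* (m ℤ.* p)) ℤ.* A ℤ.- B ≡
      (v ℤ.* v ℤ.* A ℤ.- B ℤ.- d ℤ.* (m ℤ.* p))
        ℤ.- d ℤ.* (m ℤ.* p) ℤ.* (+ 2 ℤ.* v ℤ.* A ℤ.* u ℤ.- + 1 ℤ.- e ℤ.* p)
        ℤ.+ (d ℤ.* u ℤ.* (d ℤ.* u) ℤ.* A ℤ.* m ℤ.- d ℤ.* e) ℤ.* (p ℤ.* (m ℤ.* p))
    expand = solve-∀
    collapse : ∀ x y → + 0 ℤ.- x ℤ.* + 0 ℤ.+ y ≡ y
    collapse = solve-∀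

  lift-unit-square-ratio : ∀ {A B} → ¬ (+ p ∣ + 2) → ¬ (+ p ∣ A) →
    UnitSquareRatio p (+ p) A B → ∀ j → UnitSquareRatio p (+ (p ℕ.^ suc j)) A B
  lift-unit-square-ratio {A} {B} p∤2 p∤A (v , p∤v , vvA≡B) zero =
    v , p∤v , subst (λ M → v ℤ.* v ℤ.* A ≡ B [mod M ]) (cong +_ (≡.sym (ℕ.*-identityʳ p))) vvA≡B
  lift-unit-square-ratio {A} {B} p∤2 p∤A base (suc j)
    with lift-unit-square-ratio p∤2 p∤A base j
  ... | v , p∤v , vvA≡B
    with hensel-step (p∣p^[1+k] j) (p∤a∧p∤b⇒p∤ab (p∤a∧p∤b⇒p∤ab p∤2 p∤v) p∤A) vvA≡B
  ... | v′ , v′≡v , v′v′A≡B =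
    v′ , p∤v′ , subst (λ M → v′ ℤ.* v′ ℤ.* A ≡ B [mod M ]) (≡.sym (ℤ.pos-* p (p ℕ.^ suc j))) v′v′A≡B
    where
    p∤v′ : ¬ (+ p ∣ v′)
    p∤v′ p∣v′ = p∤v (≡-mod-respects-∣ (≡-mod-∣ (p∣p^[1+k] j) v′≡v) p∣v′)

-- The prime 2

odd⇒≡1+2q : ∀ x → ¬ (+ 2 ∣ x) → x ≡ + 1 ℤ.+ x /ℕ 2 ℤ.* + 2
odd⇒≡1+2q x 2∤x with x %ℕ 2 | n%ℕd<d x 2 | a≡a%ℕn+[a/ℕn]*n x 2
... | zero        | _               | x≡2q   = ⊥-elim (2∤x (divides (x /ℕ 2) (trans x≡2q (ℤ.+-identityˡ _))))
... | suc zero    | _               | x≡1+2q = x≡1+2q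
... | suc (suc _) | s≤s (s≤s ()) | _

odd+odd-even : ∀ {x y} → ¬ (+ 2 ∣ x) → ¬ (+ 2 ∣ y) → + 2 ∣ x ℤ.+ y
odd+odd-even {x} {y} 2∤x 2∤y = divides (+ 1 ℤ.+ x /ℕ 2 ℤ.+ y /ℕ 2) (begin
  x ℤ.+ y                                                ≡⟨ cong₂ ℤ._+_ (odd⇒≡1+2q x 2∤x) (odd⇒≡1+2q y 2∤y) ⟩
  (+ 1 ℤ.+ x /ℕ 2 ℤ.* + 2) ℤ.+ (+ 1 ℤ.+ y /ℕ 2 ℤ.* + 2) ≡⟨ regroup (x /ℕ 2) (y /ℕ 2) ⟩
  (+ 1 ℤ.+ x /ℕ 2 ℤ.+ y /ℕ 2) ℤ.* + 2                   ∎)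
  where
  open ≡-Reasoning
  regroup : ∀ a b → (+ 1 ℤ.+ a ℤ.* + 2) ℤ.+ (+ 1 ℤ.+ b ℤ.* + 2) ≡ (+ 1 ℤ.+ a ℤ.+ b) ℤ.* + 2
  regroup = solve-∀

pos-2^[m+n] : ∀ m n → + (2 ℕ.^ (m ℕ.+ n)) ≡ + (2 ℕ.^ m) ℤ.* + (2 ℕ.^ n)
pos-2^[m+n] m n = trans (cong +_ (ℕ.^-distribˡ-+-* 2 m n)) (ℤ.pos-* (2 ℕ.^ m) (2 ℕ.^ n))

-- Newton's step degenerates at p = 2; instead, adding 2^(2+i) to v adds 2^(3+i)·vA to v²A
-- modulo 2^(4+i), and vA is odd, so it cancels an odd error.
hensel-step-two : ∀ i {A B v} → ¬ (+ 2 ∣ v) → ¬ (+ 2 ∣ A) →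
  v ℤ.* v ℤ.* A ≡ B [mod + (2 ℕ.^ (3 ℕ.+ i)) ] →
  UnitSquareRatio 2 (+ (2 ℕ.^ (4 ℕ.+ i))) A B
hensel-step-two i {A} {B} {v} 2∤v 2∤A (mk≡mod (divides d vvA-B≡d2^[3+i]))
  with + 2 ℤ∣.∣? d
... | yes (divides d′ refl) = v , 2∤v , mk≡mod (divides d′ (begin
  v ℤ.* v ℤ.* A ℤ.- B                   ≡⟨ vvA-B≡d2^[3+i] ⟩
  d′ ℤ.* + 2 ℤ.* + (2 ℕ.^ (3 ℕ.+ i))      ≡⟨ ℤ.*-assoc d′ (+ 2) _ ⟩
  d′ ℤ.* (+ 2 ℤ.* + (2 ℕ.^ (3 ℕ.+ i)))    ≡⟨ cong (d′ ℤ.*_) (ℤ.pos-* 2 (2 ℕ.^ (3 ℕ.+ i))) ⟨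
  d′ ℤ.* + (2 ℕ.^ (4 ℕ.+ i))              ∎))
  where open ≡-Reasoning
... | no 2∤d with odd+odd-even 2∤d (p∤a∧p∤b⇒p∤ab prime[2] 2∤v 2∤A)
... | divides c d+vA≡2c = v ℤ.+ + 4 ℤ.* g , 2∤v′ , mk≡mod (divides (c ℤ.+ g ℤ.* A) (begin
  (v ℤ.+ + 4 ℤ.* g) ℤ.* (v ℤ.+ + 4 ℤ.* g) ℤ.* A ℤ.- B
    ≡⟨ expand v A B d g c ⟩
  (v ℤ.* v ℤ.* A ℤ.- B ℤ.- d ℤ.* (+ 8 ℤ.* g)) ℤ.+ + 8 ℤ.* g ℤ.* (d ℤ.+ v ℤ.* A ℤ.- c ℤ.* + 2)
    ℤ.+ (c ℤ.+ g ℤ.* A) ℤ.* (+ 16 ℤ.* g)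
    ≡⟨ cong₂ (λ z₁ z₂ → z₁ ℤ.+ + 8 ℤ.* g ℤ.* z₂ ℤ.+ (c ℤ.+ g ℤ.* A) ℤ.* (+ 16 ℤ.* g))
             (ℤ.i≡j⇒i-j≡0 (trans vvA-B≡d2^[3+i] (cong (d ℤ.*_) (pos-2^[m+n] 3 i))))
             (ℤ.i≡j⇒i-j≡0 d+vA≡2c) ⟩
  + 0 ℤ.+ + 8 ℤ.* g ℤ.* + 0 ℤ.+ (c ℤ.+ g ℤ.* A) ℤ.* (+ 16 ℤ.* g)
    ≡⟨ collapse (+ 8 ℤ.* g) ((c ℤ.+ g ℤ.* A) ℤ.* (+ 16 ℤ.* g)) ⟩
  (c ℤ.+ g ℤ.* A) ℤ.* (+ 16 ℤ.* g)
    ≡⟨ cong ((c ℤ.+ g ℤ.* A) ℤ.*_) (pos-2^[m+n] 4 i) ⟨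
  (c ℤ.+ g ℤ.* A) ℤ.* + (2 ℕ.^ (4 ℕ.+ i)) ∎))
  where
  open ≡-Reasoning
  g = + (2 ℕ.^ i)
  2∤v′ : ¬ (+ 2 ∣ v ℤ.+ + 4 ℤ.* g)
  2∤v′ 2∣v′ = 2∤v (ℤ∣.∣m+n∣n⇒∣m 2∣v′ (ℤ∣.∣m⇒∣m*n g (divides (+ 2) refl)))
  expand : ∀ v A B d g c →
    (v ℤ.+ + 4 ℤ.* g) ℤ.* (v ℤ.+ + 4 ℤ.* g) ℤ.* A ℤ.- B ≡
    (v ℤ.* v ℤ.* A ℤ.- B ℤ.- d ℤ.* (+ 8 ℤ.* g)) ℤ.+ + 8 ℤ.* g ℤ.* (d ℤ.+ v ℤ.* A ℤ.- c ℤ.* + 2)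
      ℤ.+ (c ℤ.+ g ℤ.* A) ℤ.* (+ 16 ℤ.* g)
  expand = solve-∀
  collapse : ∀ x y → + 0 ℤ.+ x ℤ.* + 0 ℤ.+ y ≡ y
  collapse = solve-∀

lift-unit-square-ratio-two : ∀ {A B} → ¬ (+ 2 ∣ A) → A ≡ B [mod + 8 ] →
  ∀ j → UnitSquareRatio 2 (+ (2 ℕ.^ j)) A B
lift-unit-square-ratio-two {A} {B} 2∤A A≡B = λ where
    0                   → trivial (divides (+ 8) refl)
    1                   → trivial (divides (+ 4) refl)
    2                   → trivial (divides (+ 2) refl)
    (suc (suc (suc i))) → from-mod-8 i
  where
  trivial : ∀ {M} → M ∣ + 8 → UnitSquareRatio 2 M A B
  trivial M∣8 = + 1 , p∤1 prime[2] , ≡-mod-∣ M∣8 (≡-mod-trans (≡⇒≡-mod (ℤ.*-identityˡ A)) A≡B)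
  from-mod-8 : ∀ i → UnitSquareRatio 2 (+ (2 ℕ.^ (3 ℕ.+ i))) A B
  from-mod-8 zero = trivial ℤ∣.∣-refl
  from-mod-8 (suc i) with from-mod-8 i
  ... | v , 2∤v , vvA≡B = hensel-step-two i 2∤v 2∤A vvA≡B

-- Valuation, unit part and sign

module _ (q : ℕ) where

  private
    P : ℕ
    P = suc (suc q)

  ^ordAux*copAux≡id : ∀ fuel a → P ℕ.^ ordAux fuel P a ℕ.* copAux fuel P a ≡ a
  ^ordAux*copAux≡id zero       a = ℕ.+-identityʳ a
  ^ordAux*copAux≡id (suc fuel) a with a % P ℕ.≟ 0
  ... | no _       = ℕ.+-identityʳ a
  ... | yes a%P≡0 = begin
    P ℕ.* P ℕ.^ e ℕ.* c     ≡⟨ ℕ.*-assoc P (P ℕ.^ e) c ⟩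
    P ℕ.* (P ℕ.^ e ℕ.* c)   ≡⟨ cong (P ℕ.*_) (^ordAux*copAux≡id fuel (a / P)) ⟩
    P ℕ.* (a / P)           ≡⟨ ℕ.*-comm P (a / P) ⟩
    a / P ℕ.* P             ≡⟨ m/n*n≡m (ℕ.m%n≡0⇒n∣m a P a%P≡0) ⟩
    a                       ∎
    where
    open ≡-Reasoning
    e = ordAux fuel P (a / P)
    c = copAux fuel P (a / P)

  ∤copAux : ∀ fuel a → 1 ≤ a → a ≤ fuel → ¬ (P ℕ.∣ copAux fuel P a)
  ∤copAux zero       a 1≤a a≤0 _ = ℕ.<-irrefl refl (ℕ.≤-trans 1≤a a≤0)
  ∤copAux (suc fuel) a 1≤a a≤1+fuel with a % P ℕ.≟ 0
  ... | no a%P≢0  = λ P∣a → a%P≢0 (ℕ.n∣m⇒m%n≡0 a P P∣a)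
  ... | yes a%P≡0 = ∤copAux fuel (a / P) 1≤a/P (ℕ.<⇒≤pred (ℕ.<-≤-trans a/P<a a≤1+fuel))
    where
    a/P<a : a / P < a
    a/P<a = m/n<m a P {{ℕ.>-nonZero 1≤a}} (s≤s (s≤s z≤n))
    1≤a/P : 1 ≤ a / P
    1≤a/P with a / P in a/P≡
    ... | suc _ = s≤s z≤n
    ... | zero  = ⊥-elim (ℕ.<⇒≢ 1≤a (≡.sym (trans (≡.sym (m/n*n≡m (ℕ.m%n≡0⇒n∣m a P a%P≡0)))
                                                  (cong (ℕ._* P) a/P≡))))

  ord-cop-decomposition : ∀ a → P ℕ.^ ordAux (suc a) P (suc a) ℕ.* cop P (suc a) ≡ suc a
  ord-cop-decomposition a = ^ordAux*copAux≡id (suc a) (suc a)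

  ord-cop-decompositionℤ : ∀ a → + suc a ≡ + (P ℕ.^ ordAux (suc a) P (suc a)) ℤ.* + cop P (suc a)
  ord-cop-decompositionℤ a =
    trans (cong +_ (≡.sym (ord-cop-decomposition a))) (ℤ.pos-* (P ℕ.^ ordAux (suc a) P (suc a)) (cop P (suc a)))

  ∤cop : ∀ a → ¬ (P ℕ.∣ cop P (suc a))
  ∤cop a = ∤copAux (suc a) (suc a) (s≤s z≤n) ℕ.≤-refl

  ∤+cop : ∀ a → ¬ (+ P ∣ + cop P (suc a))
  ∤+cop a P∣c = ∤cop a (ℤ∣.∣⇒∣ᵤ P∣c)

  ord<k : ∀ {a k} → suc a < P ℕ.^ k → ordAux (suc a) P (suc a) < k
  ord<k {a} {k} 1+a<P^k = ℕ.≰⇒> λ k≤e → ℕ.<-irrefl refl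
    (ℕ.<-≤-trans 1+a<P^k (ℕ.≤-trans (ℕ.^-monoʳ-≤ P k≤e) P^e≤1+a))
    where
    e = ordAux (suc a) P (suc a)
    c≢0 : cop P (suc a) ≢ 0
    c≢0 c≡0 = ∤cop a (subst (P ℕ.∣_) (≡.sym c≡0) (ℕ.divides 0 refl))
    P^e≤1+a : P ℕ.^ e ≤ suc a
    P^e≤1+a = subst (P ℕ.^ e ≤_) (ord-cop-decomposition a) (ℕ.m≤m*n (P ℕ.^ e) (cop P (suc a)) {{ℕ.≢-nonZero c≢0}})

legendre-spec : ∀ q c → ¬ (suc q ℕ.∣ c) →
  legendre (suc q) c ≡ + 1 × SquareMod (suc q) c ⊎ legendre (suc q) c ≡ ℤ.-[1+ 0 ] × ¬ SquareMod (suc q) c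
legendre-spec q c p∤c with suc q ℕ.∣? c
... | yes p∣c = ⊥-elim (p∤c p∣c)
... | no _ with Fin.any? {n = suc q} (λ (x : Fin (suc q)) → (toℕ x ℕ.* toℕ x) % suc q ℕ.≟ c % suc q)
...   | yes (x , x²%p≡c%p) = inj₁ (refl , toℕ x , ≡-mod-trans (≡⇒≡-mod (≡.sym (ℤ.pos-* (toℕ x) (toℕ x))))
                                                            (%-≡⇒≡-mod x²%p≡c%p))
...   | no no-root = inj₂ (refl , λ (y , y²≡c) → no-root (reduceMod (suc q) y , ≡-mod⇒%-≡ (begin
  + (toℕ (reduceMod (suc q) y) ℕ.* toℕ (reduceMod (suc q) y))   ≡⟨ ℤ.pos-* (toℕ (reduceMod (suc q) y)) _ ⟩
  + toℕ (reduceMod (suc q) y) ℤ.* + toℕ (reduceMod (suc q) y)   ≈⟨ *-cong-mod (reduceMod-≡-mod (suc q) y)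
                                                                                (reduceMod-≡-mod (suc q) y) ⟩
  + y ℤ.* + y                                                   ≈⟨ y²≡c ⟩
  + c                                                           ∎)))
  where open ≡-mod-Reasoning (+ suc q)

odd⇒≡1+2h : ∀ {n} → ¬ (2 ℕ.∣ n) → n ≡ suc (n / 2 ℕ.+ n / 2)
odd⇒≡1+2h {n} 2∤n with n % 2 | m%n<n n 2 | m≡m%n+[m/n]*n n 2
... | zero        | _            | n≡2h   = ⊥-elim (2∤n (ℕ.divides (n / 2) n≡2h))
... | suc zero    | _            | n≡1+2h = trans n≡1+2h (cong suc (trans (ℕ.*-comm (n / 2) 2)
                                              (cong (n / 2 ℕ.+_) (ℕ.+-identityʳ (n / 2)))))
... | suc (suc _) | s≤s (s≤s ()) | _

same-legendre⇒same-squareness : ∀ q {a b} → ¬ (suc q ℕ.∣ a) → ¬ (suc q ℕ.∣ b) →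
  legendre (suc q) a ≡ legendre (suc q) b →
  SquareMod (suc q) a × SquareMod (suc q) b ⊎ ¬ SquareMod (suc q) a × ¬ SquareMod (suc q) b
same-legendre⇒same-squareness q {a} {b} p∤a p∤b a≡b
  with legendre-spec q a p∤a | legendre-spec q b p∤b
... | inj₁ (_ , a-square)    | inj₁ (_ , b-square)    = inj₁ (a-square , b-square)
... | inj₂ (_ , a-nonsquare) | inj₂ (_ , b-nonsquare) = inj₂ (a-nonsquare , b-nonsquare)
... | inj₁ (a≡1 , _)         | inj₂ (b≡-1 , _)        = contradiction (trans (≡.sym a≡1) (trans a≡b b≡-1)) λ ()
... | inj₂ (a≡-1 , _)        | inj₁ (b≡1 , _)         = contradiction (trans (≡.sym a≡-1) (trans a≡b b≡1)) λ ()

odd-prime⇒≡1+2h : ∀ q → Prime (3 ℕ.+ q) → 3 ℕ.+ q ≡ suc ((3 ℕ.+ q) / 2 ℕ.+ (3 ℕ.+ q) / 2)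
odd-prime⇒≡1+2h q P-prime = odd⇒≡1+2h 2∤P
  where
  2∤P : ¬ (2 ℕ.∣ 3 ℕ.+ q)
  2∤P 2∣P with prime⇒irreducible P-prime 2∣P
  ... | inj₁ ()
  ... | inj₂ ()

cop-unit-square-ratio : ∀ q → Prime (2 ℕ.+ q) → ∀ a b → sgn (2 ℕ.+ q) (suc a) ≡ sgn (2 ℕ.+ q) (suc b) →
  ∀ j → UnitSquareRatio (2 ℕ.+ q) (+ ((2 ℕ.+ q) ℕ.^ j)) (+ cop (2 ℕ.+ q) (suc a)) (+ cop (2 ℕ.+ q) (suc b))
cop-unit-square-ratio zero _ a b sgn≡ =
  lift-unit-square-ratio-two (∤+cop 0 a) (%-≡⇒≡-mod (ℤ.+-injective sgn≡))
cop-unit-square-ratio (suc q) P-prime a b sgn≡ zero = + 1 , p∤1 P-prime , ≡-mod-1 _ _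
cop-unit-square-ratio (suc q) P-prime a b sgn≡ (suc j) =
  lift-unit-square-ratio P-prime p∤2 (∤+cop (suc q) a)
    (same-squareness⇒unit-square-ratio P-prime {h = (3 ℕ.+ q) / 2} (odd-prime⇒≡1+2h q P-prime)
      (∤+cop (suc q) a) (∤+cop (suc q) b)
      (same-legendre⇒same-squareness (2 ℕ.+ q) (∤cop (suc q) a) (∤cop (suc q) b) sgn≡)) j
  where
  p∤2 : ¬ (+ (3 ℕ.+ q) ∣ + 2)
  p∤2 = p∤n P-prime (s≤s z≤n) (s≤s (s≤s (s≤s z≤n)))

same-sym⇒unit-square-ratio : ∀ {p} → Prime p → ∀ k {T S} → T < p ℕ.^ k →
  ord p T ≡ ord p S → sgn p T ≡ sgn p S → UnitSquareRatio p (+ (p ℕ.^ k)) (+ T) (+ S)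
same-sym⇒unit-square-ratio {zero}        ()
same-sym⇒unit-square-ratio {suc zero}    ()
same-sym⇒unit-square-ratio {suc (suc q)} P-prime k {zero}  {zero}  _ _ _ = + 1 , p∤1 P-prime , ≡-mod-refl _
same-sym⇒unit-square-ratio {suc (suc q)} P-prime k {zero}  {suc b} _ () _
same-sym⇒unit-square-ratio {suc (suc q)} P-prime k {suc a} {zero}  _ () _
same-sym⇒unit-square-ratio {suc (suc q)} P-prime k {suc a} {suc b} T<P^k ord≡ sgn≡
  with cop-unit-square-ratio q P-prime a b sgn≡ (k ℕ.∸ ordAux (suc a) (suc (suc q)) (suc a))
... | v , P∤v , vvca≡cb = v , P∤v , (begin
  v ℤ.* v ℤ.* + suc a                         ≡⟨ cong (λ z → v ℤ.* v ℤ.* z) (ord-cop-decompositionℤ q a) ⟩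
  v ℤ.* v ℤ.* (+ (P ℕ.^ e) ℤ.* + ca)          ≡⟨ regroup v (+ (P ℕ.^ e)) (+ ca) ⟩
  + (P ℕ.^ e) ℤ.* (v ℤ.* v ℤ.* + ca)          ≈⟨ P^e*vvca≡P^e*cb ⟩
  + (P ℕ.^ e) ℤ.* + cb                        ≡⟨ cong (λ e → + (P ℕ.^ e) ℤ.* + cb) e≡e′ ⟩
  + (P ℕ.^ e′) ℤ.* + cb                       ≡⟨ ord-cop-decompositionℤ q b ⟨
  + suc b                                     ∎)
  where
  open ≡-mod-Reasoning (+ (suc (suc q) ℕ.^ k))
  P = suc (suc q)
  e = ordAux (suc a) P (suc a)
  e′ = ordAux (suc b) P (suc b)
  ca = cop P (suc a)
  cb = cop P (suc b)
  e≡e′ : e ≡ e′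
  e≡e′ = just-injective ord≡
  regroup : ∀ v E c → v ℤ.* v ℤ.* (E ℤ.* c) ≡ E ℤ.* (v ℤ.* v ℤ.* c)
  regroup = solve-∀
  P^e*P^[k-e]≡P^k : + (P ℕ.^ e) ℤ.* + (P ℕ.^ (k ℕ.∸ e)) ≡ + (P ℕ.^ k)
  P^e*P^[k-e]≡P^k = trans (≡.sym (ℤ.pos-* (P ℕ.^ e) (P ℕ.^ (k ℕ.∸ e))))
    (cong +_ (trans (≡.sym (ℕ.^-distribˡ-+-* P e (k ℕ.∸ e)))
                    (cong (P ℕ.^_) (ℕ.m+[n∸m]≡n (ℕ.<⇒≤ (ord<k q T<P^k))))))
  P^e*vvca≡P^e*cb : + (P ℕ.^ e) ℤ.* (v ℤ.* v ℤ.* + ca) ≡ + (P ℕ.^ e) ℤ.* + cb [mod + (P ℕ.^ k) ]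
  P^e*vvca≡P^e*cb = subst (λ M → + (P ℕ.^ e) ℤ.* (v ℤ.* v ℤ.* + ca) ≡ + (P ℕ.^ e) ℤ.* + cb [mod M ])
    P^e*P^[k-e]≡P^k (*-scale-mod (+ (P ℕ.^ e)) vvca≡cb)

-- Counting vectors modulo a permutation of the entries

indicator : {A : Set} {P : Pred A 0ℓ} → Decidable P → A → ℕ
indicator P? x with P? x
... | yes _ = 1
... | no _  = 0

length-filter≡sum-indicator : {A : Set} {P : Pred A 0ℓ} (P? : Decidable P) (xs : List A) →
  length (filter P? xs) ≡ sum (map (indicator P?) xs)
length-filter≡sum-indicator P? []       = refl
length-filter≡sum-indicator P? (x ∷ xs) with P? x
... | yes _ = cong suc (length-filter≡sum-indicator P? xs)
... | no _  = length-filter≡sum-indicator P? xs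

indicator-cong : ∀ {A B : Set} {P : Pred A 0ℓ} {R : Pred B 0ℓ} (P? : Decidable P) (R? : Decidable R) {x y} →
  (P x → R y) → (R y → P x) → indicator P? x ≡ indicator R? y
indicator-cong P? R? {x} {y} P⇒R R⇒P with P? x | R? y
... | yes _  | yes _  = refl
... | no _   | no _   = refl
... | yes Px | no ¬Ry = ⊥-elim (¬Ry (P⇒R Px))
... | no ¬Px | yes Ry = ⊥-elim (¬Px (R⇒P Ry))

length-filter-filter : {A : Set} {P R : Pred A 0ℓ} (P? : Decidable P) (R? : Decidable R) (xs : List A) →
  length (filter R? (filter P? xs)) ≡ length (filter (λ x → P? x ×-dec R? x) xs)
length-filter-filter P? R? []       = refl
length-filter-filter P? R? (x ∷ xs) with P? x
... | no _  = length-filter-filter P? R? xs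
... | yes _ with R? x
...   | yes _ = cong suc (length-filter-filter P? R? xs)
...   | no _  = length-filter-filter P? R? xs

sum-map-concatMap : ∀ {A B : Set} (w : B → ℕ) (f : A → List B) (xs : List A) →
  sum (map w (concatMap f xs)) ≡ sum (map (λ a → sum (map w (f a))) xs)
sum-map-concatMap w f []       = refl
sum-map-concatMap w f (x ∷ xs) = begin
  sum (map w (f x List.++ concatMap f xs))           ≡⟨ cong sum (map-++ w (f x) _) ⟩
  sum (map w (f x) List.++ map w (concatMap f xs))   ≡⟨ sum-++ (map w (f x)) _ ⟩
  sum (map w (f x)) ℕ.+ sum (map w (concatMap f xs))        ≡⟨ cong (sum (map w (f x)) ℕ.+_) (sum-map-concatMap w f xs) ⟩
  sum (map w (f x)) ℕ.+ sum (map (λ a → sum (map w (f a))) xs) ∎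
  where open ≡-Reasoning

sum-tabulate : ∀ {m} (g : Fin m → ℕ) → sum (tabulate g) ≡ ∑ᶠ g
sum-tabulate {zero}  g = refl
sum-tabulate {suc m} g = cong (g Fin.zero ℕ.+_) (sum-tabulate (λ i → g (Fin.suc i)))

sum-map-allFin : ∀ {m} (h : Fin m → ℕ) → sum (map h (allFin m)) ≡ ∑ᶠ h
sum-map-allFin {m} h = trans (cong sum (map-tabulate (λ i → i) h)) (sum-tabulate h)

module _ {m : ℕ} (π : Permutation m m) where

  permuteEntries : ∀ {n} → Vector (Fin m) n → Vector (Fin m) n
  permuteEntries x i = π ⟨$⟩ʳ x i

  sum-map-allFin-permute : (h : Fin m → ℕ) →
    sum (map h (allFin m)) ≡ sum (map (λ a → h (π ⟨$⟩ʳ a)) (allFin m))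
  sum-map-allFin-permute h =
    trans (sum-map-allFin h) (trans (∑ᶠ-permute h π) (≡.sym (sum-map-allFin (λ a → h (π ⟨$⟩ʳ a)))))

  sum-map-allVecs-permute : ∀ n (w : Vector (Fin m) n → ℕ) →
    (∀ {x y} → (∀ i → x i ≡ y i) → w x ≡ w y) →
    sum (map w (allVecs n m)) ≡ sum (map (λ x → w (permuteEntries x)) (allVecs n m))
  sum-map-allVecs-permute zero    w w-ext = cong (ℕ._+ 0) (w-ext (λ ()))
  sum-map-allVecs-permute (suc n) w w-ext = begin
    sum (map w (concatMap cons (allVecs n m)))
      ≡⟨ sum-map-concatMap w cons (allVecs n m) ⟩
    sum (map (λ v → sum (map w (cons v))) (allVecs n m))
      ≡⟨ cong sum (map-cong (λ v → cong sum (≡.sym (map-∘ (allFin m)))) (allVecs n m)) ⟩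
    sum (map W (allVecs n m))
      ≡⟨ sum-map-allVecs-permute n W W-ext ⟩
    sum (map (λ v → W (permuteEntries v)) (allVecs n m))
      ≡⟨ cong sum (map-cong W∘permute (allVecs n m)) ⟩
    sum (map (λ v → sum (map (λ x → w (permuteEntries x)) (cons v))) (allVecs n m))
      ≡⟨ sum-map-concatMap (λ x → w (permuteEntries x)) cons (allVecs n m) ⟨
    sum (map (λ x → w (permuteEntries x)) (concatMap cons (allVecs n m))) ∎
    where
    open ≡-Reasoning
    cons : Vector (Fin m) n → List (Vector (Fin m) (suc n))
    cons v = map (_∷ᵥ v) (allFin m)
    W : Vector (Fin m) n → ℕ
    W v = sum (map (λ a → w (a ∷ᵥ v)) (allFin m))
    W-ext : ∀ {x y} → (∀ i → x i ≡ y i) → W x ≡ W y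
    W-ext x≗y = cong sum (map-cong (λ a → w-ext λ { Fin.zero → refl ; (Fin.suc i) → x≗y i }) (allFin m))
    W∘permute : ∀ v → W (permuteEntries v) ≡ sum (map (λ x → w (permuteEntries x)) (cons v))
    W∘permute v = begin
      W (permuteEntries v)
        ≡⟨ sum-map-allFin-permute (λ a → w (a ∷ᵥ permuteEntries v)) ⟩
      sum (map (λ a → w ((π ⟨$⟩ʳ a) ∷ᵥ permuteEntries v)) (allFin m))
        ≡⟨ cong sum (map-cong (λ a → w-ext λ { Fin.zero → refl ; (Fin.suc i) → refl }) (allFin m)) ⟩
      sum (map (λ a → w (permuteEntries (a ∷ᵥ v))) (allFin m))
        ≡⟨ cong sum (map-∘ (allFin m)) ⟩
      sum (map (λ x → w (permuteEntries x)) (cons v)) ∎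

  length-filter-allVecs-permute : ∀ n {P R : Pred (Vector (Fin m) n) 0ℓ} (P? : Decidable P) (R? : Decidable R) →
    (∀ {x y} → (∀ i → x i ≡ y i) → R x → R y) →
    (∀ x → P x → R (permuteEntries x)) → (∀ x → R (permuteEntries x) → P x) →
    length (filter P? (allVecs n m)) ≡ length (filter R? (allVecs n m))
  length-filter-allVecs-permute n P? R? R-ext P⇒R∘F R∘F⇒P = begin
    length (filter P? (allVecs n m))
      ≡⟨ length-filter≡sum-indicator P? (allVecs n m) ⟩
    sum (map (indicator P?) (allVecs n m))
      ≡⟨ cong sum (map-cong (λ x → indicator-cong P? R? (P⇒R∘F x) (R∘F⇒P x)) (allVecs n m)) ⟩
    sum (map (λ x → indicator R? (permuteEntries x)) (allVecs n m))
      ≡⟨ sum-map-allVecs-permute n (indicator R?) indicator-ext ⟨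
    sum (map (indicator R?) (allVecs n m))
      ≡⟨ length-filter≡sum-indicator R? (allVecs n m) ⟨
    length (filter R? (allVecs n m)) ∎
    where
    open ≡-Reasoning
    indicator-ext : ∀ {x y} → (∀ i → x i ≡ y i) → indicator R? x ≡ indicator R? y
    indicator-ext x≗y = indicator-cong R? R? (R-ext x≗y) (R-ext (λ i → ≡.sym (x≗y i)))

-- Quadratic forms

∑-cong : ∀ {n} {f g : Fin n → ℤ} → (∀ i → f i ≡ g i) → ∑ f ≡ ∑ g
∑-cong {zero}  f≗g = refl
∑-cong {suc n} f≗g = cong₂ ℤ._+_ (f≗g Fin.zero) (∑-cong (λ i → f≗g (Fin.suc i)))

∑-cong-mod : ∀ {M n} {f g : Fin n → ℤ} → (∀ i → f i ≡ g i [mod M ]) → ∑ f ≡ ∑ g [mod M ]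
∑-cong-mod {n = zero}  f≡g = ≡-mod-refl (+ 0)
∑-cong-mod {n = suc n} f≡g = +-cong-mod (f≡g Fin.zero) (∑-cong-mod (λ i → f≡g (Fin.suc i)))

*-distribˡ-∑ : ∀ {n} c (f : Fin n → ℤ) → ∑ (λ i → c ℤ.* f i) ≡ c ℤ.* ∑ f
*-distribˡ-∑ {zero}  c f = ≡.sym (ℤ.*-zeroʳ c)
*-distribˡ-∑ {suc n} c f =
  trans (cong (λ z → c ℤ.* f Fin.zero ℤ.+ z) (*-distribˡ-∑ c (λ i → f (Fin.suc i))))
        (≡.sym (ℤ.*-distribˡ-+ c (f Fin.zero) _))

qf-cong : ∀ {n m} (Q : Fin n → Fin n → ℤ) {x y : Vector (Fin m) n} → (∀ i → x i ≡ y i) → qf Q x ≡ qf Q y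
qf-cong Q x≗y = ∑-cong (λ i → ∑-cong (λ j →
  cong₂ (λ a b → + toℕ a ℤ.* Q i j ℤ.* + toℕ b) (x≗y i) (x≗y j)))

qf-∘-≡-mod : ∀ {n m M c} (Q : Fin n → Fin n → ℤ) (g : Fin m → Fin m) →
  (∀ a → + toℕ (g a) ≡ c ℤ.* + toℕ a [mod M ]) →
  ∀ x → qf Q (λ i → g (x i)) ≡ c ℤ.* c ℤ.* qf Q x [mod M ]
qf-∘-≡-mod {M = M} {c} Q g g≡c* x = begin
  qf Q (λ i → g (x i))
    ≈⟨ ∑-cong-mod (λ i → ∑-cong-mod (λ j → *-cong-mod (*-cong-mod (g≡c* (x i)) (≡-mod-refl (Q i j))) (g≡c* (x j)))) ⟩
  ∑ (λ i → ∑ (λ j → c ℤ.* + toℕ (x i) ℤ.* Q i j ℤ.* (c ℤ.* + toℕ (x j))))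
    ≡⟨ ∑-cong (λ i → ∑-cong (λ j → regroup c (+ toℕ (x i)) (Q i j) (+ toℕ (x j)))) ⟩
  ∑ (λ i → ∑ (λ j → c ℤ.* c ℤ.* (+ toℕ (x i) ℤ.* Q i j ℤ.* + toℕ (x j))))
    ≡⟨ ∑-cong (λ i → *-distribˡ-∑ (c ℤ.* c) (λ j → + toℕ (x i) ℤ.* Q i j ℤ.* + toℕ (x j))) ⟩
  ∑ (λ i → c ℤ.* c ℤ.* ∑ (λ j → + toℕ (x i) ℤ.* Q i j ℤ.* + toℕ (x j)))
    ≡⟨ *-distribˡ-∑ (c ℤ.* c) (λ i → ∑ (λ j → + toℕ (x i) ℤ.* Q i j ℤ.* + toℕ (x j))) ⟩
  c ℤ.* c ℤ.* qf Q x ∎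
  where
  open ≡-mod-Reasoning M
  regroup : ∀ c a q b → c ℤ.* a ℤ.* q ℤ.* (c ℤ.* b) ≡ c ℤ.* c ℤ.* (a ℤ.* q ℤ.* b)
  regroup = solve-∀

unit-square-ratio-ℕ : ∀ {p M A B} → UnitSquareRatio p M A B →
  ∃ λ V → ¬ (+ p ∣ + V) × + V ℤ.* + V ℤ.* A ≡ B [mod M ]
unit-square-ratio-ℕ {p} {A = A} (v , p∤v , vvA≡B) =
  ℤ.∣ v ∣ , (λ p∣∣v∣ → p∤v (ℤ∣.∣ᵤ⇒∣ (ℤ∣.∣⇒∣ᵤ p∣∣v∣))) ,
  ≡-mod-trans (≡⇒≡-mod (cong (ℤ._* A) (∣v∣*∣v∣≡v*v v))) vvA≡B
  where
  ∣v∣*∣v∣≡v*v : ∀ v → + ℤ.∣ v ∣ ℤ.* + ℤ.∣ v ∣ ≡ v ℤ.* v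
  ∣v∣*∣v∣≡v*v (+ _)      = refl
  ∣v∣*∣v∣≡v*v ℤ.-[1+ _ ] = refl

module _ {n} (Q : Fin n → Fin n → ℤ) {p} (p-prime : Prime p) {k} (k≥1 : k ≥ 1)
         {V} (p∤V : ¬ (+ p ∣ + V)) {t s} (V²t≡s : + V ℤ.* + V ℤ.* t ≡ s [mod + (p ℕ.^ k) ]) where

  private
    m : ℕ
    m = p ℕ.^ k

    instance
      m≢0 : NonZero m
      m≢0 = ℕ.m^n≢0 p k {{prime⇒nonZero p-prime}}

    π : Permutation m m
    π = scaleMod-permutation p-prime k p∤V

    scale : Vector (Fin m) n → Vector (Fin m) n
    scale = permuteEntries π

    qf-scale : ∀ x → qf Q (scale x) ≡ + V ℤ.* + V ℤ.* qf Q x [mod + m ]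
    qf-scale = qf-∘-≡-mod {c = + V} Q (scaleMod p-prime k V) (scaleMod-≡-mod p-prime k V)

  solves-scale : ∀ x → qf Q x mod m ≡ t mod m → qf Q (scale x) mod m ≡ s mod m
  solves-scale x Qx≡t = ≡-mod⇒mod-≡ m _ _ (begin
    qf Q (scale x)              ≈⟨ qf-scale x ⟩
    + V ℤ.* + V ℤ.* qf Q x      ≈⟨ *-congˡ-mod (+ V ℤ.* + V) (mod-≡⇒≡-mod m _ _ Qx≡t) ⟩
    + V ℤ.* + V ℤ.* t           ≈⟨ V²t≡s ⟩
    s                           ∎)
    where open ≡-mod-Reasoning (+ m)

  solves-unscale : ∀ x → qf Q (scale x) mod m ≡ s mod m → qf Q x mod m ≡ t mod m
  solves-unscale x Q[Vx]≡s = ≡-mod⇒mod-≡ m _ _ (*-cancelˡ-mod p-prime k (p∤a∧p∤b⇒p∤ab p-prime p∤V p∤V) (begin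
    + V ℤ.* + V ℤ.* qf Q x      ≈⟨ qf-scale x ⟨
    qf Q (scale x)              ≈⟨ mod-≡⇒≡-mod m _ _ Q[Vx]≡s ⟩
    s                           ≈⟨ V²t≡s ⟨
    + V ℤ.* + V ℤ.* t           ∎))
    where open ≡-mod-Reasoning (+ m)

  primitive-scale : ∀ x → Primitive p x ⇔ Primitive p (scale x)
  primitive-scale x = mk⇔
    (λ (i , p∤xi) → i , λ p∣Vxi → p∤xi (Equivalence.to (∣scaleMod⇔∣ p-prime k k≥1 p∤V (x i)) p∣Vxi))
    (λ (i , p∤Vxi) → i , λ p∣xi → p∤Vxi (Equivalence.from (∣scaleMod⇔∣ p-prime k k≥1 p∤V (x i)) p∣xi))

  solves-cong : ∀ u {x y : Vector (Fin m) n} → (∀ i → x i ≡ y i) →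
    qf Q x mod m ≡ u mod m → qf Q y mod m ≡ u mod m
  solves-cong u x≗y = subst (λ z → z mod m ≡ u mod m) (qf-cong Q x≗y)

  primitive-cong : ∀ {x y : Vector (Fin m) n} → (∀ i → x i ≡ y i) → Primitive p x → Primitive p y
  primitive-cong x≗y (i , p∤xi) = i , subst (λ a → ¬ (p ℕ.∣ toℕ a)) (x≗y i) p∤xi

  A-invariant : A p k Q t ≡ A p k Q s
  A-invariant = length-filter-allVecs-permute π n (solves? Q t) (solves? Q s)
    (solves-cong s) solves-scale solves-unscale

  B-invariant : B p k Q t ≡ B p k Q s
  B-invariant = begin
    B p k Q t
      ≡⟨ length-filter-filter (solves? Q t) (primitive? p) (allVecs n m) ⟩
    length (filter (λ x → solves? Q t x ×-dec primitive? p x) (allVecs n m))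
      ≡⟨ length-filter-allVecs-permute π n _ _
           (λ x≗y (Qx≡s , prim) → solves-cong s x≗y Qx≡s , primitive-cong x≗y prim)
           (λ x (Qx≡t , prim) → solves-scale x Qx≡t , Equivalence.to (primitive-scale x) prim)
           (λ x (Q[Vx]≡s , prim) → solves-unscale x Q[Vx]≡s , Equivalence.from (primitive-scale x) prim) ⟩
    length (filter (λ x → solves? Q s x ×-dec primitive? p x) (allVecs n m))
      ≡⟨ length-filter-filter (solves? Q s) (primitive? p) (allVecs n m) ⟨
    B p k Q s ∎
    where open ≡-Reasoning

  C-invariant : C p k Q t ≡ C p k Q s
  C-invariant = begin
    C p k Q t
      ≡⟨ length-filter-filter (solves? Q t) (λ x → ¬? (primitive? p x)) (allVecs n m) ⟩
    length (filter (λ x → solves? Q t x ×-dec ¬? (primitive? p x)) (allVecs n m))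
      ≡⟨ length-filter-allVecs-permute π n _ _
           (λ x≗y (Qx≡s , imprim) → solves-cong s x≗y Qx≡s , imprim ∘ primitive-cong (λ i → ≡.sym (x≗y i)))
           (λ x (Qx≡t , imprim) → solves-scale x Qx≡t , imprim ∘ Equivalence.from (primitive-scale x))
           (λ x (Q[Vx]≡s , imprim) → solves-unscale x Q[Vx]≡s , imprim ∘ Equivalence.to (primitive-scale x)) ⟩
    length (filter (λ x → solves? Q s x ×-dec ¬? (primitive? p x)) (allVecs n m))
      ≡⟨ length-filter-filter (solves? Q s) (λ x → ¬? (primitive? p x)) (allVecs n m) ⟨
    C p k Q s ∎
    where open ≡-Reasoning

lemma5 : (n : ℕ) (Q : Fin n → Fin n → ℤ) → (∀ i j → Q i j ≡ Q j i) →
  (p : ℕ) → Prime p → (k : ℕ) → k ≥ 1 → (t s : ℤ) →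
  sym p k t ≡ sym p k s →
  A p k Q t ≡ A p k Q s × B p k Q t ≡ B p k Q s × C p k Q t ≡ C p k Q s
lemma5 n Q _ p p-prime k k≥1 t s sym≡ =
  A-invariant Q p-prime k≥1 p∤V V²t≡s , B-invariant Q p-prime k≥1 p∤V V²t≡s , C-invariant Q p-prime k≥1 p∤V V²t≡s
  where
  instance
    p^k≢0 : NonZero (p ℕ.^ k)
    p^k≢0 = ℕ.m^n≢0 p k {{prime⇒nonZero p-prime}}
  ratio = unit-square-ratio-ℕ (same-sym⇒unit-square-ratio p-prime k (mod-< (p ℕ.^ k) t)
                                 (cong proj₁ sym≡) (cong proj₂ sym≡))
  V = proj₁ ratio
  p∤V = proj₁ (proj₂ ratio)
  V²t≡s : + V ℤ.* + V ℤ.* t ≡ s [mod + (p ℕ.^ k) ]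
  V²t≡s = begin
    + V ℤ.* + V ℤ.* t                 ≈⟨ *-congˡ-mod (+ V ℤ.* + V) (i≡i-mod-m (p ℕ.^ k) t) ⟩
    + V ℤ.* + V ℤ.* + (t mod (p ℕ.^ k)) ≈⟨ proj₂ (proj₂ ratio) ⟩
    + (s mod (p ℕ.^ k))                 ≈⟨ i≡i-mod-m (p ℕ.^ k) s ⟨
    s                                 ∎
    where open ≡-mod-Reasoning (+ (p ℕ.^ k))
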